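{- Let $q\ge 2$, $n\ge1$ and $0\le d\le (q-1)n$. Every monomial of $\mathbb{Q}[x_1,\ldots,x_n]$ that does not belong to $\mathcal B(n,q)$ is the leading monomial of some nonzero polynomial in $I(\mathcal U(n,d,q))$.
   Context: $R=\mathbb{Q}[x_1,\ldots,x_n]$ with a fixed monomial order $\prec$ satisfying $x_n\prec\cdots\prec x_1$; leading monomial means $\prec$-largest monomial. $(q)=\{0,\ldots,q-1\}$, $\mathbf x^{\mathbf v}=x_1^{v_1}\cdots x_n^{v_n}$. $\mathcal U(n,d,q)=\{\mathbf v\in(q)^n:\sum_i v_i=d\}$, and $I(\mathcal V)$ is the ideal of polynomials in $R$ vanishing on $\mathcal V$. $\mathcal B(n,q)=\{\mathbf x^{\mathbf v}:\mathbf v\in(q)^n,\ |\{i\le 2t-1: v_i=q-1\}|\le t-1 \text{ for all positive integers } t\}$. -}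

module Defs where

open import Data.Nat as ℕ using (ℕ; zero; suc; _∸_; _≤_; _<_)
import Data.Nat.Properties as ℕP
open import Data.Integer using (+_)
open import Data.Rational using (ℚ; 0ℚ; 1ℚ; _+_; _*_; _/_)
open import Data.Fin using (Fin)
open import Data.Vec using (Vec; []; _∷_; lookup; toList; zipWith)
import Data.Vec.Properties as VP
open import Data.List using (List; []; _∷_; length; filter; take)
open import Data.Product using (_×_; _,_)
open import Data.Sum using (_⊎_)
open import Relation.Nullary using (¬_; yes; no)
open import Relation.Binary.PropositionalEquality using (_≡_)
open import Induction.WellFounded using (WellFounded)

Mon : ℕ → Set
Mon n = Vec ℕ n

_⊕_ : ∀ {n} → Mon n → Mon n → Mon n
_⊕_ = zipWith ℕ._+_

-- exponent vector of the variable x_i (i is 0-indexed: i = 0 is x_1)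
unitMon : ∀ n → Fin n → Mon n
unitMon (suc n) Fin.zero = 1 ∷ Data.Vec.replicate n 0
unitMon (suc n) (Fin.suc i) = 0 ∷ unitMon n i

zeroMon : ∀ n → Mon n
zeroMon n = Data.Vec.replicate n 0

record MonomialOrder (n : ℕ) : Set₁ where
  field
    _≺_       : Mon n → Mon n → Set
    irrefl    : ∀ a → ¬ (a ≺ a)
    trans     : ∀ {a b c} → a ≺ b → b ≺ c → a ≺ c
    total     : ∀ a b → a ≺ b ⊎ a ≡ b ⊎ b ≺ a
    compat    : ∀ {a b} c → a ≺ b → (a ⊕ c) ≺ (b ⊕ c)
    wellFound : WellFounded _≺_

VarsDecreasing : ∀ {n} → MonomialOrder n → Set
VarsDecreasing {n} O =
  ∀ (i j : Fin n) → Data.Fin.toℕ j ≡ suc (Data.Fin.toℕ i) →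
    MonomialOrder._≺_ O (unitMon n j) (unitMon n i)

-- Polynomials in ℚ[x_1,…,x_n] as formal finite sums of terms c·x^v
-- (repeated monomials allowed; coefficients are collected by `coeff`).
Poly : ℕ → Set
Poly n = List (ℚ × Mon n)

coeff : ∀ {n} → Poly n → Mon n → ℚ
coeff [] m = 0ℚ
coeff ((c , v) ∷ p) m with VP.≡-dec ℕP._≟_ v m
... | yes _ = c + coeff p m
... | no  _ = coeff p m

powℚ : ℚ → ℕ → ℚ
powℚ a zero = 1ℚ
powℚ a (suc k) = a * powℚ a k

fromℕℚ : ℕ → ℚ
fromℕℚ k = (+ k) / 1

evalMon : ∀ {n} → Vec ℚ n → Mon n → ℚ
evalMon [] [] = 1ℚ
evalMon (a ∷ as) (e ∷ es) = powℚ a e * evalMon as es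

eval : ∀ {n} → Poly n → Vec ℚ n → ℚ
eval [] a = 0ℚ
eval ((c , v) ∷ p) a = c * evalMon a v + eval p a

IsLeadingMonomial : ∀ {n} → MonomialOrder n → Poly n → Mon n → Set
IsLeadingMonomial {n} O f m =
  ¬ (coeff f m ≡ 0ℚ) ×
  (∀ (w : Mon n) → ¬ (coeff f w ≡ 0ℚ) → w ≡ m ⊎ MonomialOrder._≺_ O w m)

InBox : ∀ {n} → ℕ → Vec ℕ n → Set
InBox {n} q v = ∀ (i : Fin n) → lookup v i < q

sumVec : ∀ {n} → Vec ℕ n → ℕ
sumVec [] = 0
sumVec (x ∷ xs) = x ℕ.+ sumVec xs

InU : ∀ {n} → ℕ → ℕ → Vec ℕ n → Set
InU d q v = InBox q v × sumVec v ≡ d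

VanishesOnU : ∀ {n} → ℕ → ℕ → Poly n → Set
VanishesOnU {n} d q f =
  ∀ (v : Vec ℕ n) → InU d q v → eval f (Data.Vec.map fromℕℚ v) ≡ 0ℚ

-- |{ i ≤ k : v_i = q-1 }|  (1-indexed coordinates, i.e. among the first k)
countTop : ∀ {n} → ℕ → ℕ → Vec ℕ n → ℕ
countTop q k v = length (filter (λ a → a ℕP.≟ (q ∸ 1)) (take k (toList v)))

InB : ∀ {n} → ℕ → Mon n → Set
InB q v = InBox q v ×
  (∀ (t : ℕ) → 1 ≤ t → countTop q (2 ℕ.* t ∸ 1) v ≤ t ∸ 1)

module Submission where

-- If some v_i ≥ q, then x^v is a multiple of x_i^q, the leading monomial of x_i (x_i - 1) ⋯ (x_i - q + 1),
-- which vanishes on (q)^n. Otherwise, writing Q = q - 1, x^v ∉ ℬ(n,q) means that some initial segment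
-- of v has more entries equal to Q than not, so reading v from the left we reach a first position where
-- the coordinates T with v_i = Q outnumber the others E by one; let R be the later coordinates. On 𝒰
-- the linear form Σ_{i ∈ T ∪ R} x_i + |E| Q - d takes values in {0, …, |E| Q}, so its falling factorial
-- of degree |E| Q + 1 vanishes there. Expanding that falling factorial by Vandermonde's identity and
-- dropping the falling factorials of single variables of degree > Q (which vanish on the box) gives an
-- element of I(𝒰) whose leading exponent, as x_n ≺ ⋯ ≺ x_1, puts degree Q greedily on the earliest
-- variables, which are those of T; hence it divides x^v.

open import Defs renaming (_⊕_ to infixl 6 _⊕_)
open import Data.Nat as ℕ using (ℕ; zero; suc; _∸_; _⊓_; _*_; _≤_; _<_; _≤?_; _<?_; z≤n; s≤s)
import Data.Nat.Properties as ℕP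
open import Data.Nat.Combinatorics using (_C_; k>n⇒nCk≡0; nCk+nC[k+1]≡[n+1]C[k+1])
import Data.Integer as ℤ
import Data.Integer.Properties as ℤP
open import Data.Rational as ℚ using (ℚ; 0ℚ; 1ℚ; _+_; _-_; -_) renaming (_*_ to infixl 7 _·_)
import Data.Rational.Properties as ℚP
import Data.Rational.Unnormalised as ℚᵘ
import Data.Rational.Unnormalised.Properties as ℚᵘP
open import Data.Fin as F using (Fin; toℕ)
import Data.Fin.Properties as FP
open import Data.Vec as V using (Vec; []; _∷_; lookup; zipWith)
import Data.Vec.Properties as VP
open import Data.List as L using (List; []; _∷_; _++_; length)
import Data.List.Properties as LP
open import Data.Nat.ListAction using (sum)
open import Data.Nat.ListAction.Properties using (sum-++)
open import Data.List.Relation.Unary.All as All using (All; []; _∷_)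
open import Data.List.Relation.Unary.AllPairs as AP using (AllPairs; []; _∷_)
import Data.List.Relation.Unary.AllPairs.Properties as APP
import Data.List.Relation.Unary.All.Properties as AllP
open import Data.Product using (Σ; _×_; _,_; proj₂)
open import Data.Sum using (_⊎_; inj₁; inj₂)
open import Data.Empty using (⊥; ⊥-elim)
open import Function using (_∘_; id)
open import Induction.WellFounded using (Acc; acc)
open import Relation.Binary.PropositionalEquality
open import Relation.Nullary using (¬_; Dec; yes; no)
open import Relation.Nullary.Decidable using (dec⇒maybe)
open import Tactic.RingSolver.Core.AlmostCommutativeRing using (AlmostCommutativeRing; fromCommutativeRing)
open import Tactic.RingSolver using (solve-∀)
import Data.Nat.Tactic.RingSolver as ℕ-Solver

ℚ-ring : AlmostCommutativeRing _ _
ℚ-ring = fromCommutativeRing ℚP.+-*-commutativeRing (λ x → dec⇒maybe (0ℚ ℚP.≟ x))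

fromℕℚ-+ : ∀ a b → fromℕℚ (a ℕ.+ b) ≡ fromℕℚ a + fromℕℚ b
fromℕℚ-+ a b = ℚP.toℚᵘ-injective (begin
    ℚ.toℚᵘ (fromℕℚ (a ℕ.+ b))                ≈⟨ toℚᵘ-fromℕℚ (a ℕ.+ b) ⟩
    ℚᵘ.mkℚᵘ (ℤ.+ (a ℕ.+ b)) 0                   ≈⟨ ℚᵘ.*≡* cross ⟩
    ℚᵘ.mkℚᵘ (ℤ.+ a) 0 ℚᵘ.+ ℚᵘ.mkℚᵘ (ℤ.+ b) 0      ≈⟨ ℚᵘP.+-cong (toℚᵘ-fromℕℚ a) (toℚᵘ-fromℕℚ b) ⟨
    ℚ.toℚᵘ (fromℕℚ a) ℚᵘ.+ ℚ.toℚᵘ (fromℕℚ b)  ≈⟨ ℚP.toℚᵘ-homo-+ (fromℕℚ a) (fromℕℚ b) ⟨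
    ℚ.toℚᵘ (fromℕℚ a + fromℕℚ b)              ∎)
  where
  open ℚᵘP.≃-Reasoning
  toℚᵘ-fromℕℚ : ∀ k → ℚ.toℚᵘ (fromℕℚ k) ℚᵘ.≃ ℚᵘ.mkℚᵘ (ℤ.+ k) 0
  toℚᵘ-fromℕℚ k = ℚP.toℚᵘ-fromℚᵘ (ℚᵘ.mkℚᵘ (ℤ.+ k) 0)
  cross : ℤ.+ (a ℕ.+ b) ℤ.* ℤ.+ 1 ≡ (ℤ.+ a ℤ.* ℤ.+ 1 ℤ.+ ℤ.+ b ℤ.* ℤ.+ 1) ℤ.* ℤ.+ 1
  cross = cong (ℤ._* ℤ.+ 1) (sym (cong₂ ℤ._+_ (ℤP.*-identityʳ (ℤ.+ a)) (ℤP.*-identityʳ (ℤ.+ b))))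

fromℕℚ-positive : ∀ {k} → 1 ≤ k → ℚ.Positive (fromℕℚ k)
fromℕℚ-positive {suc k} _ = ℚP.normalize-pos (suc k) 1

positive⇒≢0 : ∀ p → ℚ.Positive p → ¬ p ≡ 0ℚ
positive⇒≢0 p pos = ≢-sym (ℚP.<⇒≢ (ℚP.positive⁻¹ p {{pos}}))

fromℕℚ-∸ : ∀ {s D} → s ≤ D → fromℕℚ D ≡ fromℕℚ s + fromℕℚ (D ∸ s)
fromℕℚ-∸ {s} {D} s≤D = trans (cong fromℕℚ (sym (ℕP.m+[n∸m]≡n s≤D))) (fromℕℚ-+ s (D ∸ s))

sumUpTo : ℕ → (ℕ → ℚ) → ℚ
sumUpTo zero    f = f 0
sumUpTo (suc y) f = sumUpTo y f + f (suc y)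

sumUpTo-cong : ∀ y {f g : ℕ → ℚ} → (∀ s → s ≤ y → f s ≡ g s) → sumUpTo y f ≡ sumUpTo y g
sumUpTo-cong zero    f≗g = f≗g 0 z≤n
sumUpTo-cong (suc y) f≗g =
  cong₂ _+_ (sumUpTo-cong y (λ s s≤y → f≗g s (ℕP.m≤n⇒m≤1+n s≤y))) (f≗g (suc y) ℕP.≤-refl)

sumUpTo-+ : ∀ y (f g : ℕ → ℚ) → sumUpTo y (λ s → f s + g s) ≡ sumUpTo y f + sumUpTo y g
sumUpTo-+ zero    f g = refl
sumUpTo-+ (suc y) f g = trans (cong (_+ (f (suc y) + g (suc y))) (sumUpTo-+ y f g))
  (interchange (sumUpTo y f) (sumUpTo y g) (f (suc y)) (g (suc y)))
  where
  interchange : ∀ a b c d → (a + b) + (c + d) ≡ (a + c) + (b + d)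
  interchange = solve-∀ ℚ-ring

sumUpTo-·ʳ : ∀ y (f : ℕ → ℚ) c → sumUpTo y (λ s → f s · c) ≡ sumUpTo y f · c
sumUpTo-·ʳ zero    f c = refl
sumUpTo-·ʳ (suc y) f c = trans (cong (_+ f (suc y) · c) (sumUpTo-·ʳ y f c))
  (sym (ℚP.*-distribʳ-+ c (sumUpTo y f) (f (suc y))))

sumUpTo-suc : ∀ y (f : ℕ → ℚ) → sumUpTo (suc y) f ≡ f 0 + sumUpTo y (λ s → f (suc s))
sumUpTo-suc zero    f = refl
sumUpTo-suc (suc y) f = trans (cong (_+ f (suc (suc y))) (sumUpTo-suc y f)) (ℚP.+-assoc (f 0) _ _)

sumUpTo-truncate : ∀ {m y} (f : ℕ → ℚ) → (∀ s → m < s → f s ≡ 0ℚ) → m ≤ y →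
                   sumUpTo y f ≡ sumUpTo m f
sumUpTo-truncate {m} {zero}  f vanish z≤n = refl
sumUpTo-truncate {m} {suc y} f vanish m≤1+y with m ℕ.≟ suc y
... | yes refl = refl
... | no m≢1+y = trans (cong₂ _+_ (sumUpTo-truncate f vanish (ℕP.≤-pred m<1+y)) (vanish (suc y) m<1+y))
                       (ℚP.+-identityʳ _)
  where m<1+y = ℕP.≤∧≢⇒< m≤1+y m≢1+y

falling : ℚ → ℕ → ℚ
falling x zero    = 1ℚ
falling x (suc s) = falling x s · (x - fromℕℚ s)

falling-vanishes : ∀ {b s} → b < s → falling (fromℕℚ b) s ≡ 0ℚ
falling-vanishes {b} {suc s} b<1+s with b ℕ.≟ s
... | yes refl = trans (cong (falling (fromℕℚ b) b ·_) (ℚP.+-inverseʳ (fromℕℚ b)))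
                       (ℚP.*-zeroʳ (falling (fromℕℚ b) b))
... | no b≢s = trans (cong (_· (fromℕℚ b - fromℕℚ s)) (falling-vanishes (ℕP.≤∧≢⇒< (ℕP.≤-pred b<1+s) b≢s)))
                     (ℚP.*-zeroˡ (fromℕℚ b - fromℕℚ s))

binomial : ℕ → ℕ → ℚ
binomial D s = fromℕℚ (D C s)

binomial-positive : ∀ {D s} → s ≤ D → ℚ.Positive (binomial D s)
binomial-positive s≤D = fromℕℚ-positive (C-positive s≤D)
  where
  C-positive : ∀ {D s} → s ≤ D → 1 ≤ D C s
  C-positive {D}     {zero}  _         = ℕP.≤-refl
  C-positive {suc D} {suc s} (s≤s s≤D) = ℕP.≤-trans (C-positive s≤D)
    (subst (D C s ≤_) (nCk+nC[k+1]≡[n+1]C[k+1] D s) (ℕP.m≤m+n _ _))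

falling-vandermonde : ∀ D a b → falling (a + b) D ≡ sumUpTo D (λ s → binomial D s · (falling a s · falling b (D ∸ s)))
falling-vandermonde zero    a b = refl
falling-vandermonde (suc D) a b = begin
    falling (a + b) D · ((a + b) - fromℕℚ D)
  ≡⟨ cong (_· ((a + b) - fromℕℚ D)) (falling-vandermonde D a b) ⟩
    sumUpTo D term · ((a + b) - fromℕℚ D)
  ≡⟨ sym (sumUpTo-·ʳ D term _) ⟩
    sumUpTo D (λ s → term s · ((a + b) - fromℕℚ D))
  ≡⟨ sumUpTo-cong D split ⟩
    sumUpTo D (λ s → raiseA s + raiseB s)
  ≡⟨ sumUpTo-+ D raiseA raiseB ⟩
    sumUpTo D raiseA + sumUpTo D raiseB
  ≡⟨ cong (sumUpTo D raiseA +_) raiseB-shift ⟩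
    sumUpTo D raiseA + (raiseB 0 + sumUpTo D raiseB′)
  ≡⟨ rotate (sumUpTo D raiseA) (raiseB 0) (sumUpTo D raiseB′) ⟩
    raiseB 0 + (sumUpTo D raiseA + sumUpTo D raiseB′)
  ≡⟨ cong (raiseB 0 +_) (sym (sumUpTo-+ D raiseA raiseB′)) ⟩
    raiseB 0 + sumUpTo D (λ s → raiseA s + raiseB′ s)
  ≡⟨ cong (raiseB 0 +_) (sumUpTo-cong D (λ s _ → sym (pascal s))) ⟩
    raiseB 0 + sumUpTo D (λ s → term′ (suc s))
  ≡⟨ sym (sumUpTo-suc D term′) ⟩
    sumUpTo (suc D) term′ ∎
  where
  open ≡-Reasoning
  term term′ raiseA raiseB raiseB′ : ℕ → ℚ
  term    s = binomial D s · (falling a s · falling b (D ∸ s))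
  term′   s = binomial (suc D) s · (falling a s · falling b (suc D ∸ s))
  raiseA  s = binomial D s · (falling a (suc s) · falling b (D ∸ s))
  raiseB  s = binomial D s · (falling a s · falling b (suc D ∸ s))
  raiseB′ s = binomial D (suc s) · (falling a (suc s) · falling b (D ∸ s))

  rotate : ∀ x y z → x + (y + z) ≡ y + (x + z)
  rotate = solve-∀ ℚ-ring

  -- (a + b) - D = (a - s) + (b - (D - s)) splits each term in two.
  split : ∀ s → s ≤ D → term s · ((a + b) - fromℕℚ D) ≡ raiseA s + raiseB s
  split s s≤D rewrite ℕP.+-∸-assoc 1 s≤D =
    trans (cong (λ z → term s · ((a + b) - z)) (fromℕℚ-∸ s≤D))
      (distribute (binomial D s) (falling a s) (falling b (D ∸ s)) a b (fromℕℚ s) (fromℕℚ (D ∸ s)))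
    where
    distribute : ∀ x f g a b s t → x · (f · g) · ((a + b) - (s + t)) ≡
                 x · ((f · (a - s)) · g) + x · (f · (g · (b - t)))
    distribute = solve-∀ ℚ-ring

  raiseB-shift : sumUpTo D raiseB ≡ raiseB 0 + sumUpTo D raiseB′
  raiseB-shift = begin
      sumUpTo D raiseB
    ≡⟨ sym (ℚP.+-identityʳ _) ⟩
      sumUpTo D raiseB + 0ℚ
    ≡⟨ cong (sumUpTo D raiseB +_) (sym (trans (cong (λ k → fromℕℚ k · rest) (k>n⇒nCk≡0 (ℕP.n<1+n D)))
                                              (ℚP.*-zeroˡ rest))) ⟩
      sumUpTo (suc D) raiseB
    ≡⟨ sumUpTo-suc D raiseB ⟩
      raiseB 0 + sumUpTo D raiseB′ ∎
    where rest = falling a (suc D) · falling b (suc D ∸ suc D)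

  pascal : ∀ s → term′ (suc s) ≡ raiseA s + raiseB′ s
  pascal s = trans (cong (λ k → fromℕℚ k · rest) (sym (nCk+nC[k+1]≡[n+1]C[k+1] D s)))
    (trans (cong (_· rest) (fromℕℚ-+ (D C s) (D C suc s))) (ℚP.*-distribʳ-+ rest (binomial D s) (binomial D (suc s))))
    where rest = falling a (suc s) · falling b (D ∸ s)

infixl 6 _⊝_
infix 4 _∣ₘ_

_⊝_ : ∀ {n} → Mon n → Mon n → Mon n
_⊝_ = zipWith _∸_

_∣ₘ_ : ∀ {n} → Mon n → Mon n → Set
g ∣ₘ v = ∀ j → lookup g j ≤ lookup v j

lookup-⊕ : ∀ {n} (u w : Mon n) i → lookup (u ⊕ w) i ≡ lookup u i ℕ.+ lookup w i
lookup-⊕ u w i = VP.lookup-zipWith ℕ._+_ i u w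

lookup-zeroMon : ∀ {n} (i : Fin n) → lookup (zeroMon n) i ≡ 0
lookup-zeroMon i = VP.lookup-replicate i 0

⊕-comm : ∀ {n} (u w : Mon n) → u ⊕ w ≡ w ⊕ u
⊕-comm = VP.zipWith-comm ℕP.+-comm

⊕-assoc : ∀ {n} (u w z : Mon n) → (u ⊕ w) ⊕ z ≡ u ⊕ (w ⊕ z)
⊕-assoc = VP.zipWith-assoc ℕP.+-assoc

⊕-identityˡ : ∀ {n} (u : Mon n) → zeroMon n ⊕ u ≡ u
⊕-identityˡ = VP.zipWith-identityˡ ℕP.+-identityˡ

⊕-cancelˡ : ∀ {n} (u : Mon n) {a b} → u ⊕ a ≡ u ⊕ b → a ≡ b
⊕-cancelˡ []      {[]}    {[]}    eq = refl
⊕-cancelˡ (x ∷ u) {y ∷ a} {z ∷ b} eq =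
  cong₂ _∷_ (ℕP.+-cancelˡ-≡ x y z (cong V.head eq)) (⊕-cancelˡ u (cong V.tail eq))

v⊝g⊕g≡v : ∀ {n} {v g : Mon n} → g ∣ₘ v → (v ⊝ g) ⊕ g ≡ v
v⊝g⊕g≡v {v = []}    {[]}    _   = refl
v⊝g⊕g≡v {v = x ∷ v} {y ∷ g} g∣v = cong₂ _∷_ (ℕP.m∸n+n≡m (g∣v F.zero)) (v⊝g⊕g≡v (g∣v ∘ F.suc))

varPow : ∀ {n} → Fin n → ℕ → Mon n
varPow {suc n} F.zero    k = k ∷ zeroMon n
varPow {suc n} (F.suc i) k = 0 ∷ varPow i k

varPow-zero : ∀ {n} (i : Fin n) → varPow i 0 ≡ zeroMon n
varPow-zero F.zero    = refl
varPow-zero (F.suc i) = cong (0 ∷_) (varPow-zero i)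

varPow-+ : ∀ {n} (i : Fin n) a b → varPow i (a ℕ.+ b) ≡ varPow i a ⊕ varPow i b
varPow-+ {suc n} F.zero    a b = cong (a ℕ.+ b ∷_) (sym (⊕-identityˡ (zeroMon n)))
varPow-+ {suc n} (F.suc i) a b = cong (0 ∷_) (varPow-+ i a b)

varPow-suc : ∀ {n} (i : Fin n) k → varPow i (suc k) ≡ varPow i k ⊕ varPow i 1
varPow-suc i k = trans (cong (varPow i) (ℕP.+-comm 1 k)) (varPow-+ i k 1)

unitMon≡varPow : ∀ {n} (i : Fin n) → unitMon n i ≡ varPow i 1
unitMon≡varPow F.zero    = refl
unitMon≡varPow (F.suc i) = cong (0 ∷_) (unitMon≡varPow i)

lookup-varPow : ∀ {n} (i : Fin n) k → lookup (varPow i k) i ≡ k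
lookup-varPow F.zero    k = refl
lookup-varPow (F.suc i) k = lookup-varPow i k

lookup-varPow-≢ : ∀ {n} {i j : Fin n} k → i ≢ j → lookup (varPow i k) j ≡ 0
lookup-varPow-≢ {i = F.zero}  {F.zero}  k i≢j = ⊥-elim (i≢j refl)
lookup-varPow-≢ {i = F.zero}  {F.suc j} k i≢j = lookup-zeroMon j
lookup-varPow-≢ {i = F.suc i} {F.zero}  k i≢j = refl
lookup-varPow-≢ {i = F.suc i} {F.suc j} k i≢j = lookup-varPow-≢ k (i≢j ∘ cong F.suc)

module MonomialOrderProperties {n : ℕ} (O : MonomialOrder n) where
  open MonomialOrder O public using () renaming (_≺_ to infix 4 _≺_; trans to ≺-trans)
  open MonomialOrder O using (irrefl; total; compat; wellFound)

  infix 4 _≼_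
  _≼_ : Mon n → Mon n → Set
  a ≼ b = a ≡ b ⊎ a ≺ b

  ≼-≺-trans : ∀ {a b c} → a ≼ b → b ≺ c → a ≺ c
  ≼-≺-trans (inj₁ refl) b≺c = b≺c
  ≼-≺-trans (inj₂ a≺b)  b≺c = ≺-trans a≺b b≺c

  ≺⇒≢ : ∀ {a b} → a ≺ b → a ≢ b
  ≺⇒≢ {a} a≺b refl = irrefl a a≺b

  ⊕-monoˡ-≺ : ∀ {a b} c → a ≺ b → a ⊕ c ≺ b ⊕ c
  ⊕-monoˡ-≺ = compat

  ⊕-monoʳ-≺ : ∀ {a b} c → a ≺ b → c ⊕ a ≺ c ⊕ b
  ⊕-monoʳ-≺ {a} {b} c a≺b = subst₂ _≺_ (⊕-comm a c) (⊕-comm b c) (compat c a≺b)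

  ⊕-monoʳ-≼ : ∀ {a b} c → a ≼ b → c ⊕ a ≼ c ⊕ b
  ⊕-monoʳ-≼ c (inj₁ refl) = inj₁ refl
  ⊕-monoʳ-≼ c (inj₂ a≺b)  = inj₂ (⊕-monoʳ-≺ c a≺b)

  -- b ≺ 1 would give the infinite descent 1 ≻ b ≻ b² ≻ ⋯
  zeroMon-minimal : ∀ b → ¬ b ≺ zeroMon n
  zeroMon-minimal b b≺0 = descend (zeroMon n) (wellFound (zeroMon n))
    where
    descend : ∀ a → Acc _≺_ a → ⊥
    descend a (acc rs) = descend (a ⊕ b) (rs (subst₂ _≺_ (⊕-comm b a) (⊕-identityˡ a) (compat a b≺0)))

  zeroMon-≼ : ∀ b → zeroMon n ≼ b
  zeroMon-≼ b with total (zeroMon n) b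
  ... | inj₁ 0≺b        = inj₂ 0≺b
  ... | inj₂ (inj₁ 0≡b) = inj₁ 0≡b
  ... | inj₂ (inj₂ b≺0) = ⊥-elim (zeroMon-minimal b b≺0)

  zeroMon-≺-varPow : ∀ (i : Fin n) k → zeroMon n ≺ varPow i (suc k)
  zeroMon-≺-varPow i k with zeroMon-≼ (varPow i (suc k))
  ... | inj₂ 0≺x = 0≺x
  ... | inj₁ 0≡x = ⊥-elim (ℕP.0≢1+n (trans (sym (lookup-zeroMon i))
                                           (trans (cong (λ z → lookup z i) 0≡x) (lookup-varPow i (suc k)))))

  module _ (varsDecreasing : VarsDecreasing O) where

    varPow1-≺ : ∀ {i j : Fin n} → toℕ i < toℕ j → varPow j 1 ≺ varPow i 1
    varPow1-≺ {i} {j} i<j = subst₂ _≺_ (unitMon≡varPow j) (unitMon≡varPow i)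
      (go (toℕ j ∸ suc (toℕ i)) j (sym (ℕP.m+[n∸m]≡n i<j)))
      where
      go : ∀ d (j : Fin n) → toℕ j ≡ suc (toℕ i) ℕ.+ d → unitMon n j ≺ unitMon n i
      go zero    j eq = varsDecreasing i j (trans eq (cong suc (ℕP.+-identityʳ (toℕ i))))
      go (suc d) j eq = ≺-trans (varsDecreasing j′ j (trans eq (trans (ℕP.+-suc (suc (toℕ i)) d) (cong suc (sym j′≡)))))
                                (go d j′ j′≡)
        where
        j′<n : suc (toℕ i) ℕ.+ d < n
        j′<n = ℕP.<-trans (ℕP.n<1+n _) (subst (_< n) (trans eq (ℕP.+-suc (suc (toℕ i)) d)) (FP.toℕ<n j))
        j′ : Fin n
        j′ = F.fromℕ< j′<n
        j′≡ : toℕ j′ ≡ suc (toℕ i) ℕ.+ d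
        j′≡ = FP.toℕ-fromℕ< j′<n

infixr 7 _·ₜ_
infixl 7 _⊗_

_·ₜ_ : ∀ {n} → ℚ × Mon n → Poly n → Poly n
t       ·ₜ []            = []
(c , u) ·ₜ ((b , w) ∷ p) = (c · b , u ⊕ w) ∷ (c , u) ·ₜ p

_⊗_ : ∀ {n} → Poly n → Poly n → Poly n
[]      ⊗ p = []
(t ∷ P) ⊗ p = t ·ₜ p ++ P ⊗ p

constant : ∀ {n} → ℚ → Poly n
constant {n} c = (c , zeroMon n) ∷ []

monomial : ∀ {n} → Mon n → Poly n
monomial u = (1ℚ , u) ∷ []

sumPoly : ∀ {n} → ℕ → (ℕ → Poly n) → Poly n
sumPoly zero    F = F 0
sumPoly (suc M) F = sumPoly M F ++ F (suc M)

fallingPoly : ∀ {n} → Fin n → ℕ → Poly n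
fallingPoly     i zero    = constant 1ℚ
fallingPoly {n} i (suc s) = fallingPoly i s ⊗ ((1ℚ , varPow i 1) ∷ (- fromℕℚ s , zeroMon n) ∷ [])

coeff-++ : ∀ {n} (p q : Poly n) m → coeff (p ++ q) m ≡ coeff p m + coeff q m
coeff-++ []            q m = sym (ℚP.+-identityˡ _)
coeff-++ ((c , u) ∷ p) q m with VP.≡-dec ℕP._≟_ u m
... | yes _ = trans (cong (c +_) (coeff-++ p q m)) (sym (ℚP.+-assoc c _ _))
... | no  _ = coeff-++ p q m

coeff-here : ∀ {n} c (u : Mon n) p → coeff ((c , u) ∷ p) u ≡ c + coeff p u
coeff-here c u p with VP.≡-dec ℕP._≟_ u u
... | yes _   = refl
... | no  u≢u = ⊥-elim (u≢u refl)

coeff-there : ∀ {n} c {u m : Mon n} p → u ≢ m → coeff ((c , u) ∷ p) m ≡ coeff p m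
coeff-there c {u} {m} p u≢m with VP.≡-dec ℕP._≟_ u m
... | yes u≡m = ⊥-elim (u≢m u≡m)
... | no  _   = refl

coeff-·ₜ : ∀ {n} c (u : Mon n) p m → coeff ((c , u) ·ₜ p) (u ⊕ m) ≡ c · coeff p m
coeff-·ₜ c u []            m = sym (ℚP.*-zeroʳ c)
coeff-·ₜ c u ((b , w) ∷ p) m with VP.≡-dec ℕP._≟_ w m
... | yes refl = trans (coeff-here (c · b) (u ⊕ w) _)
                       (trans (cong (c · b +_) (coeff-·ₜ c u p w)) (sym (ℚP.*-distribˡ-+ c b _)))
... | no  w≢m  = trans (coeff-there (c · b) _ (w≢m ∘ ⊕-cancelˡ u)) (coeff-·ₜ c u p m)

powℚ-+ : ∀ a e f → powℚ a (e ℕ.+ f) ≡ powℚ a e · powℚ a f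
powℚ-+ a zero    f = sym (ℚP.*-identityˡ _)
powℚ-+ a (suc e) f = trans (cong (a ·_) (powℚ-+ a e f)) (sym (ℚP.*-assoc a _ _))

evalMon-⊕ : ∀ {n} (a : Vec ℚ n) u w → evalMon a (u ⊕ w) ≡ evalMon a u · evalMon a w
evalMon-⊕ []      []      []      = sym (ℚP.*-identityˡ _)
evalMon-⊕ (x ∷ a) (e ∷ u) (f ∷ w) = trans (cong₂ _·_ (powℚ-+ x e f) (evalMon-⊕ a u w))
  (interchange (powℚ x e) (powℚ x f) (evalMon a u) (evalMon a w))
  where
  interchange : ∀ p q r s → (p · q) · (r · s) ≡ (p · r) · (q · s)
  interchange = solve-∀ ℚ-ring

evalMon-zeroMon : ∀ {n} (a : Vec ℚ n) → evalMon a (zeroMon n) ≡ 1ℚ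
evalMon-zeroMon []      = refl
evalMon-zeroMon (x ∷ a) = trans (ℚP.*-identityˡ _) (evalMon-zeroMon a)

evalMon-varPow1 : ∀ {n} (a : Vec ℚ n) i → evalMon a (varPow i 1) ≡ lookup a i
evalMon-varPow1 (x ∷ a) F.zero    =
  trans (cong (x · 1ℚ ·_) (evalMon-zeroMon a)) (trans (ℚP.*-identityʳ _) (ℚP.*-identityʳ x))
evalMon-varPow1 (x ∷ a) (F.suc i) = trans (ℚP.*-identityˡ _) (evalMon-varPow1 a i)

eval-constant : ∀ {n} c (a : Vec ℚ n) → eval (constant c) a ≡ c
eval-constant c a = trans (ℚP.+-identityʳ _) (trans (cong (c ·_) (evalMon-zeroMon a)) (ℚP.*-identityʳ c))

eval-++ : ∀ {n} (p q : Poly n) a → eval (p ++ q) a ≡ eval p a + eval q a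
eval-++ []            q a = sym (ℚP.+-identityˡ _)
eval-++ ((c , u) ∷ p) q a = trans (cong (c · evalMon a u +_) (eval-++ p q a))
                                  (sym (ℚP.+-assoc (c · evalMon a u) (eval p a) (eval q a)))

eval-·ₜ : ∀ {n} c (u : Mon n) p a → eval ((c , u) ·ₜ p) a ≡ (c · evalMon a u) · eval p a
eval-·ₜ c u []            a = sym (ℚP.*-zeroʳ (c · evalMon a u))
eval-·ₜ c u ((b , w) ∷ p) a = trans (cong₂ _+_ (cong (c · b ·_) (evalMon-⊕ a u w)) (eval-·ₜ c u p a))
  (factor c b (evalMon a u) (evalMon a w) (eval p a))
  where
  factor : ∀ c b x y z → c · b · (x · y) + c · x · z ≡ c · x · (b · y + z)
  factor = solve-∀ ℚ-ring

eval-⊗ : ∀ {n} (P p : Poly n) a → eval (P ⊗ p) a ≡ eval P a · eval p a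
eval-⊗ []            p a = sym (ℚP.*-zeroˡ (eval p a))
eval-⊗ ((c , u) ∷ P) p a = trans (eval-++ ((c , u) ·ₜ p) (P ⊗ p) a)
  (trans (cong₂ _+_ (eval-·ₜ c u p a) (eval-⊗ P p a)) (sym (ℚP.*-distribʳ-+ (eval p a) (c · evalMon a u) (eval P a))))

eval-sumPoly : ∀ {n} M (F : ℕ → Poly n) a → eval (sumPoly M F) a ≡ sumUpTo M (λ s → eval (F s) a)
eval-sumPoly zero    F a = refl
eval-sumPoly (suc M) F a = trans (eval-++ (sumPoly M F) (F (suc M)) a) (cong (_+ eval (F (suc M)) a) (eval-sumPoly M F a))

eval-fallingPoly : ∀ {n} (i : Fin n) s a → eval (fallingPoly i s) a ≡ falling (lookup a i) s
eval-fallingPoly i zero    a = eval-constant 1ℚ a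
eval-fallingPoly i (suc s) a = trans (eval-⊗ (fallingPoly i s) _ a)
  (cong₂ _·_ (eval-fallingPoly i s a)
             (cong₂ _+_ (trans (ℚP.*-identityˡ _) (evalMon-varPow1 a i)) (eval-constant (- fromℕℚ s) a)))

module TopTerms {n : ℕ} (O : MonomialOrder n) where
  open MonomialOrder O using (compat)
  open MonomialOrderProperties O

  TopTerm : Poly n → Mon n → ℚ → Set
  TopTerm p m κ = All (λ t → proj₂ t ≼ m) p × coeff p m ≡ κ

  coeff-above : ∀ p {m} → All (λ t → proj₂ t ≺ m) p → coeff p m ≡ 0ℚ
  coeff-above []            []           = refl
  coeff-above ((c , u) ∷ p) (u≺m ∷ p≺m) = trans (coeff-there c p (≺⇒≢ u≺m)) (coeff-above p p≺m)

  TopTerm-below : ∀ {p m′ m κ} → TopTerm p m′ κ → m′ ≺ m → TopTerm p m 0ℚ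
  TopTerm-below {p} (p≼m′ , _) m′≺m = All.map inj₂ p≺m , coeff-above p p≺m
    where p≺m = All.map (λ u≼m′ → ≼-≺-trans u≼m′ m′≺m) p≼m′

  TopTerm-++ : ∀ {p q m κ κ′} → TopTerm p m κ → TopTerm q m κ′ → TopTerm (p ++ q) m (κ + κ′)
  TopTerm-++ {p} {q} {m} (p≼m , cp) (q≼m , cq) = AllP.++⁺ p≼m q≼m , trans (coeff-++ p q m) (cong₂ _+_ cp cq)

  TopTerm-single : ∀ c m → TopTerm ((c , m) ∷ []) m c
  TopTerm-single c m = inj₁ refl ∷ [] , trans (coeff-here c m []) (ℚP.+-identityʳ c)

  TopTerm-·ₜ : ∀ {p m κ} c u → TopTerm p m κ → TopTerm ((c , u) ·ₜ p) (u ⊕ m) (c · κ)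
  TopTerm-·ₜ {p} {m} c u (p≼m , cp) = shift p p≼m , trans (coeff-·ₜ c u p m) (cong (c ·_) cp)
    where
    shift : ∀ p → All (λ t → proj₂ t ≼ m) p → All (λ t → proj₂ t ≼ u ⊕ m) ((c , u) ·ₜ p)
    shift []      []           = []
    shift (_ ∷ p) (w≼m ∷ p≼m) = ⊕-monoʳ-≼ u w≼m ∷ shift p p≼m

  TopTerm-⊗ : ∀ {P M K p m κ} → TopTerm P M K → TopTerm p m κ → TopTerm (P ⊗ p) (M ⊕ m) (K · κ)
  TopTerm-⊗ {[]} {K = K} {κ = κ} ([] , cP) _ = [] , trans (sym (ℚP.*-zeroˡ κ)) (cong (_· κ) cP)
  TopTerm-⊗ {(c , u) ∷ P} {K = K} {p} {m} {κ} (inj₁ refl ∷ P≼u , cP) top-p =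
    subst (TopTerm (((c , u) ∷ P) ⊗ p) (u ⊕ m)) coeff≡
      (TopTerm-++ (TopTerm-·ₜ c u top-p) (TopTerm-⊗ (P≼u , refl) top-p))
    where
    coeff≡ : c · κ + coeff P u · κ ≡ K · κ
    coeff≡ = trans (sym (ℚP.*-distribʳ-+ κ c (coeff P u))) (cong (_· κ) (trans (sym (coeff-here c u P)) cP))
  TopTerm-⊗ {(c , u) ∷ P} {M} {K} {p} {m} {κ} (inj₂ u≺M ∷ P≼M , cP) top-p =
    subst (TopTerm (((c , u) ∷ P) ⊗ p) (M ⊕ m)) coeff≡
      (TopTerm-++ (TopTerm-below (TopTerm-·ₜ c u top-p) (compat m u≺M)) (TopTerm-⊗ (P≼M , refl) top-p))
    where
    coeff≡ : 0ℚ + coeff P M · κ ≡ K · κ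
    coeff≡ = trans (ℚP.+-identityˡ _) (cong (_· κ) (trans (sym (coeff-there c P (≺⇒≢ u≺M))) cP))

  nonzero-coeff-≼ : ∀ p {m} → All (λ t → proj₂ t ≼ m) p → ∀ w → coeff p w ≢ 0ℚ → w ≼ m
  nonzero-coeff-≼ []            []           w cw≢0 = ⊥-elim (cw≢0 refl)
  nonzero-coeff-≼ ((c , u) ∷ p) (u≼m ∷ p≼m) w cw≢0 with VP.≡-dec ℕP._≟_ u w
  ... | yes refl = u≼m
  ... | no  _    = nonzero-coeff-≼ p p≼m w cw≢0

  TopTerm⇒IsLeadingMonomial : ∀ {p m κ} → TopTerm p m κ → κ ≢ 0ℚ → IsLeadingMonomial O p m
  TopTerm⇒IsLeadingMonomial {p} (p≼m , cp) κ≢0 = κ≢0 ∘ trans (sym cp) , nonzero-coeff-≼ p p≼m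

  TopTerm-sumPoly : ∀ s₀ (F : ℕ → Poly n) {m κ} → (∀ s → s < s₀ → TopTerm (F s) m 0ℚ) →
                    TopTerm (F s₀) m κ → TopTerm (sumPoly s₀ F) m κ
  TopTerm-sumPoly zero      F     below top = top
  TopTerm-sumPoly (suc s₀) F {m} {κ} below top = subst (TopTerm (sumPoly (suc s₀) F) m) (ℚP.+-identityˡ κ)
    (TopTerm-++ (TopTerm-sumPoly s₀ F (λ s s<s₀ → below s (ℕP.m<n⇒m<1+n s<s₀)) (below s₀ (ℕP.n<1+n s₀))) top)

  TopTerm-fallingPoly : ∀ (i : Fin n) s → TopTerm (fallingPoly i s) (varPow i s) 1ℚ
  TopTerm-fallingPoly i zero    = subst (λ m → TopTerm (constant 1ℚ) m 1ℚ) (sym (varPow-zero i)) (TopTerm-single 1ℚ _)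
  TopTerm-fallingPoly i (suc s) = subst (λ m → TopTerm (fallingPoly i (suc s)) m 1ℚ) (sym (varPow-suc i s))
    (TopTerm-⊗ (TopTerm-fallingPoly i s)
      (TopTerm-++ (TopTerm-single 1ℚ (varPow i 1)) (TopTerm-below (TopTerm-single _ (zeroMon n)) (zeroMon-≺-varPow i 0))))

Sorted : ∀ {n} → List (Fin n) → Set
Sorted = AllPairs F._<_

sumOverℚ : ∀ {n} → List (Fin n) → Vec ℚ n → ℚ
sumOverℚ []      a = 0ℚ
sumOverℚ (i ∷ L) a = lookup a i + sumOverℚ L a

sumOver : ∀ {m} → List (Fin m) → Vec ℕ m → ℕ
sumOver X w = sum (L.map (lookup w) X)

sumOver-++ : ∀ {m} (X Y : List (Fin m)) w → sumOver (X ++ Y) w ≡ sumOver X w ℕ.+ sumOver Y w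
sumOver-++ X Y w = trans (cong sum (LP.map-++ (lookup w) X Y)) (sum-++ (L.map (lookup w) X) _)

sumOver-map-suc : ∀ {m} (X : List (Fin m)) y w → sumOver (L.map F.suc X) (y ∷ w) ≡ sumOver X w
sumOver-map-suc X y w = cong sum (sym (LP.map-∘ X))

allFin-suc : ∀ m → L.allFin (suc m) ≡ F.zero ∷ L.map F.suc (L.allFin m)
allFin-suc m = cong (F.zero ∷_) (sym (LP.map-tabulate id F.suc))

sumOver-allFin : ∀ {m} (w : Vec ℕ m) → sumOver (L.allFin m) w ≡ sumVec w
sumOver-allFin         []      = refl
sumOver-allFin {suc m} (y ∷ w) = trans (cong (λ X → sumOver X (y ∷ w)) (allFin-suc m))
  (cong (y ℕ.+_) (trans (sumOver-map-suc (L.allFin m) y w) (sumOver-allFin w)))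

Sorted-map-suc : ∀ {m} {X : List (Fin m)} → Sorted X → Sorted (L.map F.suc X)
Sorted-map-suc = APP.map⁺ ∘ AP.map s≤s

zero<map-suc : ∀ {m} (X : List (Fin m)) → All (F.zero {m} F.<_) (L.map F.suc X)
zero<map-suc {m} X = AllP.map⁺ (All.universal {P = λ j → F.zero {m} F.< F.suc j} (λ _ → s≤s z≤n) X)

Sorted-allFin : ∀ m → Sorted (L.allFin m)
Sorted-allFin zero    = []
Sorted-allFin (suc m) =
  subst Sorted (sym (allFin-suc m)) (zero<map-suc (L.allFin m) ∷ Sorted-map-suc (Sorted-allFin m))

sumOverℚ-fromℕℚ : ∀ {m} (X : List (Fin m)) (u : Vec ℕ m) → sumOverℚ X (V.map fromℕℚ u) ≡ fromℕℚ (sumOver X u)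
sumOverℚ-fromℕℚ []      u = refl
sumOverℚ-fromℕℚ (i ∷ X) u = trans (cong₂ _+_ (VP.lookup-map i fromℕℚ u) (sumOverℚ-fromℕℚ X u))
                               (sym (fromℕℚ-+ (lookup u i) (sumOver X u)))

sumOver-≤ : ∀ {m Q} (X : List (Fin m)) (u : Vec ℕ m) → (∀ i → lookup u i ≤ Q) → sumOver X u ≤ length X * Q
sumOver-≤ []      u u≤Q = z≤n
sumOver-≤ (i ∷ X) u u≤Q = ℕP.+-mono-≤ (u≤Q i) (sumOver-≤ X u u≤Q)

m∸[m⊓n]≡m∸n : ∀ m n → m ∸ (m ⊓ n) ≡ m ∸ n
m∸[m⊓n]≡m∸n m n with ℕP.≤-total m n
... | inj₁ m≤n = trans (cong (m ∸_) (ℕP.m≤n⇒m⊓n≡m m≤n)) (trans (ℕP.n∸n≡0 m) (sym (ℕP.m≤n⇒m∸n≡0 m≤n)))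
... | inj₂ n≤m = cong (m ∸_) (ℕP.m≥n⇒m⊓n≡n n≤m)

-- falling (Σ_{i ∈ L} x_i + c) D expanded by Vandermonde's identity, one variable at a time, keeping only
-- the falling factorials of each x_i of degree ≤ Q: both agree on points with coordinates in {0, …, Q}.
module CappedExpansion {n : ℕ} (Q : ℕ) where

  expansion : List (Fin n) → ℚ → ℕ → Poly n
  expansion []      c D = constant (falling c D)
  expansion (i ∷ L) c D =
    sumPoly (D ⊓ Q) (λ s → (binomial D s , zeroMon n) ·ₜ (fallingPoly i s ⊗ expansion L c (D ∸ s)))

  greedy : List (Fin n) → ℕ → Mon n
  greedy []      D = zeroMon n
  greedy (i ∷ L) D = varPow i (D ⊓ Q) ⊕ greedy L (D ∸ (D ⊓ Q))

  leadCoeff : List (Fin n) → ℚ → ℕ → ℚ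
  leadCoeff []      c D = falling c D
  leadCoeff (i ∷ L) c D = binomial D (D ⊓ Q) · leadCoeff L c (D ∸ (D ⊓ Q))

  eval-expansion : ∀ L c D (b : Vec ℕ n) → All (λ i → lookup b i ≤ Q) L →
                   eval (expansion L c D) (V.map fromℕℚ b) ≡ falling (sumOverℚ L (V.map fromℕℚ b) + c) D
  eval-expansion []      c D b _ =
    trans (eval-constant (falling c D) (V.map fromℕℚ b)) (cong (λ z → falling z D) (sym (ℚP.+-identityˡ c)))
  eval-expansion (i ∷ L) c D b (bᵢ≤Q ∷ b≤Q) = begin
      eval (sumPoly (D ⊓ Q) term) a
    ≡⟨ eval-sumPoly (D ⊓ Q) term a ⟩
      sumUpTo (D ⊓ Q) (λ s → eval (term s) a)
    ≡⟨ sumUpTo-cong (D ⊓ Q) (λ s _ → eval-term s) ⟩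
      sumUpTo (D ⊓ Q) summand
    ≡⟨ sumUpTo-truncate summand vanish (ℕP.⊓-monoʳ-≤ D bᵢ≤Q) ⟩
      sumUpTo (D ⊓ lookup b i) summand
    ≡⟨ sumUpTo-truncate summand vanish (ℕP.m⊓n≤m D (lookup b i)) ⟨
      sumUpTo D summand
    ≡⟨ falling-vandermonde D x y ⟨
      falling (x + y) D
    ≡⟨ cong (λ z → falling (z + y) D) (VP.lookup-map i fromℕℚ b) ⟨
      falling (lookup a i + (sumOverℚ L a + c)) D
    ≡⟨ cong (λ z → falling z D) (ℚP.+-assoc (lookup a i) (sumOverℚ L a) c) ⟨
      falling (sumOverℚ (i ∷ L) a + c) D ∎
    where
    open ≡-Reasoning
    a = V.map fromℕℚ b
    x = fromℕℚ (lookup b i)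
    y = sumOverℚ L a + c
    term : ℕ → Poly n
    term s = (binomial D s , zeroMon n) ·ₜ (fallingPoly i s ⊗ expansion L c (D ∸ s))
    summand : ℕ → ℚ
    summand s = binomial D s · (falling x s · falling y (D ∸ s))
    eval-term : ∀ s → eval (term s) a ≡ summand s
    eval-term s = trans (eval-·ₜ (binomial D s) (zeroMon n) (fallingPoly i s ⊗ expansion L c (D ∸ s)) a)
      (cong₂ _·_ (trans (cong (binomial D s ·_) (evalMon-zeroMon a)) (ℚP.*-identityʳ (binomial D s)))
        (trans (eval-⊗ (fallingPoly i s) (expansion L c (D ∸ s)) a)
          (cong₂ _·_ (trans (eval-fallingPoly i s a) (cong (λ z → falling z s) (VP.lookup-map i fromℕℚ b)))
                     (eval-expansion L c (D ∸ s) b b≤Q))))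
    vanish : ∀ s → D ⊓ lookup b i < s → summand s ≡ 0ℚ
    vanish s s>D⊓bᵢ with s ≤? lookup b i
    ... | no  s≰bᵢ = trans (cong (λ z → binomial D s · (z · falling y (D ∸ s))) (falling-vanishes (ℕP.≰⇒> s≰bᵢ)))
                          (trans (cong (binomial D s ·_) (ℚP.*-zeroˡ (falling y (D ∸ s)))) (ℚP.*-zeroʳ (binomial D s)))
    ... | yes s≤bᵢ = trans (cong (λ k → fromℕℚ k · (falling x s · falling y (D ∸ s))) (k>n⇒nCk≡0 s>D))
                          (ℚP.*-zeroˡ (falling x s · falling y (D ∸ s)))
      where s>D = ℕP.≰⇒> (λ s≤D → ℕP.<⇒≱ s>D⊓bᵢ (ℕP.⊓-glb s≤D s≤bᵢ))

  leftover-≤ : ∀ {D k} → D ≤ suc k * Q → D ∸ (D ⊓ Q) ≤ k * Q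
  leftover-≤ {D} {k} D≤ = subst (_≤ k * Q) (sym (m∸[m⊓n]≡m∸n D Q)) (ℕP.m≤n+o⇒m∸n≤o D Q D≤)

  leadCoeff-positive : ∀ L c D → D ≤ L.length L * Q → ℚ.Positive (leadCoeff L c D)
  leadCoeff-positive []      c zero _  = _
  leadCoeff-positive (i ∷ L) c D  D≤ =
    ℚP.pos*pos⇒pos (binomial D (D ⊓ Q)) {{binomial-positive (ℕP.m⊓n≤m D Q)}}
                   (leadCoeff L c (D ∸ (D ⊓ Q))) {{leadCoeff-positive L c _ (leftover-≤ {k = L.length L} D≤)}}

  greedy-zero : ∀ L → greedy L 0 ≡ zeroMon n
  greedy-zero []      = refl
  greedy-zero (i ∷ L) = trans (cong₂ _⊕_ (varPow-zero i) (greedy-zero L)) (⊕-identityˡ _)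

  greedy-∷-≤ : ∀ i L {D} → D ≤ Q → greedy (i ∷ L) D ≡ varPow i D ⊕ zeroMon n
  greedy-∷-≤ i L {D} D≤Q rewrite ℕP.m≤n⇒m⊓n≡m D≤Q | ℕP.n∸n≡0 D = cong (varPow i D ⊕_) (greedy-zero L)

  greedy-∷-≥ : ∀ i L {D} → Q ≤ D → greedy (i ∷ L) D ≡ varPow i Q ⊕ greedy L (D ∸ Q)
  greedy-∷-≥ i L {D} Q≤D rewrite ℕP.m≥n⇒m⊓n≡n Q≤D = refl

  lookup-greedy-∉ : ∀ {i} L → All (i F.<_) L → ∀ D → lookup (greedy L D) i ≡ 0
  lookup-greedy-∉ {i} []      _            D = lookup-zeroMon i
  lookup-greedy-∉ {i} (j ∷ L) (i<j ∷ i<L) D = trans (lookup-⊕ (varPow j (D ⊓ Q)) _ i)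
    (cong₂ ℕ._+_ (lookup-varPow-≢ (D ⊓ Q) (λ j≡i → ℕP.<-irrefl (cong toℕ (sym j≡i)) i<j))
                 (lookup-greedy-∉ L i<L (D ∸ (D ⊓ Q))))

  greedy-∣ₘ : ∀ {v : Mon n} T R D → All (λ i → lookup v i ≡ Q) T → D ≤ L.length T * Q →
              Sorted (T ++ R) → greedy (T ++ R) D ∣ₘ v
  greedy-∣ₘ {v} [] R zero _ _ _ j = subst (_≤ lookup v j)
    (sym (trans (cong (λ g → lookup g j) (greedy-zero R)) (lookup-zeroMon j))) z≤n
  greedy-∣ₘ {v} (i ∷ T) R D (vᵢ≡Q ∷ T-top) D≤ (i<TR ∷ sorted) j
    rewrite lookup-⊕ (varPow i (D ⊓ Q)) (greedy (T ++ R) (D ∸ (D ⊓ Q))) j with i F.≟ j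
  ... | yes refl rewrite lookup-varPow i (D ⊓ Q) | lookup-greedy-∉ (T ++ R) i<TR (D ∸ (D ⊓ Q)) | vᵢ≡Q =
    ℕP.≤-trans (ℕP.≤-reflexive (ℕP.+-identityʳ _)) (ℕP.m⊓n≤n D Q)
  ... | no  i≢j  rewrite lookup-varPow-≢ (D ⊓ Q) i≢j =
    greedy-∣ₘ {v} T R _ T-top (leftover-≤ {k = L.length T} D≤) sorted j

  module _ (O : MonomialOrder n) (varsDecreasing : VarsDecreasing O) where
    open MonomialOrderProperties O
    open TopTerms O

    ⊕-swapʳ : ∀ (x y z : Mon n) → (x ⊕ y) ⊕ z ≡ (x ⊕ z) ⊕ y
    ⊕-swapʳ x y z = trans (⊕-assoc x y z) (trans (cong (x ⊕_) (⊕-comm y z)) (sym (⊕-assoc x z y)))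

    greedy-suc-≺ : ∀ {i} L → All (i F.<_) L → ∀ a → greedy L (suc a) ≺ greedy L a ⊕ varPow i 1
    greedy-suc-≺ {i} [] _ a = subst (zeroMon n ≺_) (sym (⊕-identityˡ _)) (zeroMon-≺-varPow i 0)
    greedy-suc-≺ {i} (j ∷ L) (i<j ∷ i<L) a with a <? Q
    ... | yes a<Q = subst₂ _≺_ (sym (greedy-∷-≤ j L a<Q))
                               (sym (cong (_⊕ varPow i 1) (greedy-∷-≤ j L (ℕP.<⇒≤ a<Q))))
      (subst₂ _≺_ (cong (_⊕ zeroMon n) (sym (varPow-suc j a))) (⊕-swapʳ (varPow j a) (varPow i 1) (zeroMon n))
        (⊕-monoˡ-≺ (zeroMon n) (⊕-monoʳ-≺ (varPow j a) (varPow1-≺ varsDecreasing i<j))))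
    ... | no  a≮Q = subst₂ _≺_
      (sym (trans (greedy-∷-≥ j L Q≤1+a) (cong (λ d → varPow j Q ⊕ greedy L d) (ℕP.+-∸-assoc 1 Q≤a))))
      (trans (sym (⊕-assoc (varPow j Q) _ _)) (cong (_⊕ varPow i 1) (sym (greedy-∷-≥ j L Q≤a))))
      (⊕-monoʳ-≺ (varPow j Q) (greedy-suc-≺ L i<L (a ∸ Q)))
      where
      Q≤a = ℕP.≮⇒≥ a≮Q
      Q≤1+a = ℕP.m≤n⇒m≤1+n Q≤a

    greedy-+-≺ : ∀ {i} L → All (i F.<_) L → ∀ a b → 1 ≤ b → greedy L (a ℕ.+ b) ≺ greedy L a ⊕ varPow i b
    greedy-+-≺ {i} L i<L a (suc b) _ = go b
      where
      go : ∀ b → greedy L (a ℕ.+ suc b) ≺ greedy L a ⊕ varPow i (suc b)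
      go zero    = subst₂ _≺_ (cong (greedy L) (sym (ℕP.+-comm a 1))) refl (greedy-suc-≺ L i<L a)
      go (suc b) = subst₂ _≺_ (cong (greedy L) (sym (ℕP.+-suc a (suc b))))
        (trans (⊕-assoc (greedy L a) _ _) (cong (greedy L a ⊕_) (sym (varPow-suc i (suc b)))))
        (≺-trans (greedy-suc-≺ L i<L (a ℕ.+ suc b)) (⊕-monoˡ-≺ (varPow i 1) (go b)))

    TopTerm-expansion : ∀ L c D → Sorted L → TopTerm (expansion L c D) (greedy L D) (leadCoeff L c D)
    TopTerm-expansion []      c D _ = TopTerm-single (falling c D) (zeroMon n)
    TopTerm-expansion (i ∷ L) c D (i<L ∷ sorted) =
      TopTerm-sumPoly s₀ term (λ s s<s₀ → TopTerm-below (top s) (lower s s<s₀))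
        (subst₂ (TopTerm (term s₀)) (⊕-identityˡ _) (cong (binomial D s₀ ·_) (ℚP.*-identityˡ _)) (top s₀))
      where
      s₀ = D ⊓ Q
      term : ℕ → Poly n
      term s = (binomial D s , zeroMon n) ·ₜ (fallingPoly i s ⊗ expansion L c (D ∸ s))
      top : ∀ s → TopTerm (term s) (zeroMon n ⊕ (varPow i s ⊕ greedy L (D ∸ s)))
                          (binomial D s · (1ℚ · leadCoeff L c (D ∸ s)))
      top s = TopTerm-·ₜ (binomial D s) (zeroMon n)
                (TopTerm-⊗ (TopTerm-fallingPoly i s) (TopTerm-expansion L c (D ∸ s) sorted))
      lower : ∀ s → s < s₀ → zeroMon n ⊕ (varPow i s ⊕ greedy L (D ∸ s)) ≺ greedy (i ∷ L) D
      lower s s<s₀ = subst₂ _≺_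
        (trans (cong (λ d → varPow i s ⊕ greedy L d) (sym D∸s≡)) (sym (⊕-identityˡ _))) regroup
        (⊕-monoʳ-≺ (varPow i s) (greedy-+-≺ L i<L (D ∸ s₀) (s₀ ∸ s) (ℕP.m<n⇒0<n∸m s<s₀)))
        where
        s≤s₀ = ℕP.<⇒≤ s<s₀
        D∸s≡ : D ∸ s ≡ (D ∸ s₀) ℕ.+ (s₀ ∸ s)
        D∸s≡ = trans (cong (_∸ s) (sym (ℕP.m∸n+n≡m (ℕP.m⊓n≤m D Q)))) (ℕP.+-∸-assoc (D ∸ s₀) s≤s₀)
        regroup : varPow i s ⊕ (greedy L (D ∸ s₀) ⊕ varPow i (s₀ ∸ s)) ≡ greedy (i ∷ L) D
        regroup = trans (cong (varPow i s ⊕_) (⊕-comm _ _)) (trans (sym (⊕-assoc _ _ _))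
          (cong (_⊕ greedy L (D ∸ s₀))
                (trans (sym (varPow-+ i s (s₀ ∸ s))) (cong (varPow i) (ℕP.m+[n∸m]≡n s≤s₀)))))

-- T and E are the coordinates of an initial segment of v equal resp. unequal to top, R the later ones.
record TopSplit {m} (top : ℕ) (v : Vec ℕ m) (e : ℕ) : Set where
  field
    T E R     : List (Fin m)
    length-T  : length T ≡ length E ℕ.+ suc e
    T-top     : All (λ i → lookup v i ≡ top) T
    sorted    : Sorted (T ++ R)
    partition : ∀ w → sumOver T w ℕ.+ sumOver E w ℕ.+ sumOver R w ≡ sumVec w

module _ {top : ℕ} where

  TopSplit-here : ∀ {m x} (v : Vec ℕ m) → x ≡ top → TopSplit top (x ∷ v) 0
  TopSplit-here {m} v x≡top = record
    { T = F.zero ∷ [] ; E = [] ; R = L.map F.suc (L.allFin m)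
    ; length-T  = refl
    ; T-top     = x≡top ∷ []
    ; sorted    = zero<map-suc (L.allFin m) ∷ Sorted-map-suc (Sorted-allFin m)
    ; partition = λ { (y ∷ w) → trans (cong (ℕ._+ sumOver (L.map F.suc (L.allFin m)) (y ∷ w))
                                              (trans (ℕP.+-identityʳ (y ℕ.+ 0)) (ℕP.+-identityʳ y)))
                                        (cong (y ℕ.+_) (trans (sumOver-map-suc (L.allFin m) y w) (sumOver-allFin w))) }
    }

  TopSplit-∷-top : ∀ {m x e} {v : Vec ℕ m} → x ≡ top → TopSplit top v e → TopSplit top (x ∷ v) (suc e)
  TopSplit-∷-top {m} {x} {e} x≡top split = record
    { T = F.zero ∷ L.map F.suc T ; E = L.map F.suc E ; R = L.map F.suc R
    ; length-T  = trans (cong suc (trans (LP.length-map F.suc T) length-T))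
                    (trans (sym (ℕP.+-suc (length E) (suc e))) (cong (ℕ._+ suc (suc e)) (sym (LP.length-map F.suc E))))
    ; T-top     = x≡top ∷ AllP.map⁺ T-top
    ; sorted    = subst Sorted (cong (F.zero ∷_) (LP.map-++ F.suc T R)) (zero<map-suc (T ++ R) ∷ Sorted-map-suc sorted)
    ; partition = partition′
    }
    where
    open TopSplit split
    regroup : ∀ y a b c → y ℕ.+ a ℕ.+ b ℕ.+ c ≡ y ℕ.+ (a ℕ.+ b ℕ.+ c)
    regroup = ℕ-Solver.solve-∀
    partition′ : ∀ w → sumOver (F.zero ∷ L.map F.suc T) w ℕ.+ sumOver (L.map F.suc E) w ℕ.+ sumOver (L.map F.suc R) w
                       ≡ sumVec w
    partition′ (y ∷ w) rewrite sumOver-map-suc T y w | sumOver-map-suc E y w | sumOver-map-suc R y w =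
      trans (regroup y (sumOver T w) (sumOver E w) (sumOver R w)) (cong (y ℕ.+_) (partition w))

  TopSplit-∷-other : ∀ {m x e} {v : Vec ℕ m} → x ≢ top → TopSplit top v (suc e) → TopSplit top (x ∷ v) e
  TopSplit-∷-other {m} {x} {e} x≢top split = record
    { T = L.map F.suc T ; E = F.zero ∷ L.map F.suc E ; R = L.map F.suc R
    ; length-T  = trans (LP.length-map F.suc T) (trans length-T (trans (ℕP.+-suc (length E) (suc e))
                    (cong (λ k → suc k ℕ.+ suc e) (sym (LP.length-map F.suc E)))))
    ; T-top     = AllP.map⁺ T-top
    ; sorted    = subst Sorted (LP.map-++ F.suc T R) (Sorted-map-suc sorted)
    ; partition = partition′
    }
    where
    open TopSplit split
    regroup : ∀ y a b c → a ℕ.+ (y ℕ.+ b) ℕ.+ c ≡ y ℕ.+ (a ℕ.+ b ℕ.+ c)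
    regroup = ℕ-Solver.solve-∀
    partition′ : ∀ w → sumOver (L.map F.suc T) w ℕ.+ sumOver (F.zero ∷ L.map F.suc E) w ℕ.+ sumOver (L.map F.suc R) w
                       ≡ sumVec w
    partition′ (y ∷ w) rewrite sumOver-map-suc T y w | sumOver-map-suc E y w | sumOver-map-suc R y w =
      trans (regroup y (sumOver T w) (sumOver E w) (sumOver R w)) (cong (y ℕ.+_) (partition w))

module _ (q : ℕ) where

  countTop-accept : ∀ {m} k {x} (v : Vec ℕ m) → x ≡ q ∸ 1 → countTop q (suc k) (x ∷ v) ≡ suc (countTop q k v)
  countTop-accept k v x≡top = cong length (LP.filter-accept (λ a → a ℕP.≟ (q ∸ 1)) x≡top)

  countTop-reject : ∀ {m} k {x} (v : Vec ℕ m) → x ≢ q ∸ 1 → countTop q (suc k) (x ∷ v) ≡ countTop q k v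
  countTop-reject k v x≢top = cong length (LP.filter-reject (λ a → a ℕP.≟ (q ∸ 1)) x≢top)

  countTop-[] : ∀ k → countTop q k [] ≡ 0
  countTop-[] zero    = refl
  countTop-[] (suc k) = refl

  countTop-≤ : ∀ {m} k (v : Vec ℕ m) → countTop q k v ≤ m
  countTop-≤ k v = ℕP.≤-trans (LP.length-filter (λ a → a ℕP.≟ (q ∸ 1)) (L.take k (V.toList v)))
    (ℕP.≤-trans (ℕP.≤-reflexive (LP.length-take k (V.toList v)))
                (ℕP.≤-trans (ℕP.m⊓n≤n k _) (ℕP.≤-reflexive (VP.length-toList v))))

  -- Reading v from the left, stop as soon as the top entries outnumber the others by one; the
  -- hypothesis, that top entries are in the majority among the first ℓ, guarantees this happens.
  topSplit : ∀ {m} (v : Vec ℕ m) e ℓ → e ℕ.+ ℓ < 2 * countTop q ℓ v → TopSplit (q ∸ 1) v e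
  topSplit []      e ℓ crowded = ⊥-elim (ℕP.n≮0 (subst (λ c → e ℕ.+ ℓ < 2 * c) (countTop-[] ℓ) crowded))
  topSplit (x ∷ v) e zero    crowded = ⊥-elim (ℕP.n≮0 crowded)
  topSplit {suc m} (x ∷ v) e (suc ℓ) crowded with x ℕP.≟ (q ∸ 1) | e
  ... | yes x≡top | zero  = TopSplit-here v x≡top
  ... | yes x≡top | suc e = TopSplit-∷-top x≡top (topSplit v e ℓ crowded′)
    where
    crowded′ : e ℕ.+ ℓ < 2 * countTop q ℓ v
    crowded′ = ℕP.≤-pred (ℕP.≤-pred (subst₂ _<_ (cong suc (ℕP.+-suc e ℓ))
                 (trans (cong (2 *_) (countTop-accept ℓ v x≡top)) (ℕP.*-suc 2 _)) crowded))
  ... | no  x≢top | e     = TopSplit-∷-other x≢top (topSplit v (suc e) ℓ crowded′)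
    where
    crowded′ : suc e ℕ.+ ℓ < 2 * countTop q ℓ v
    crowded′ = subst₂ _<_ (ℕP.+-suc e ℓ) (cong (2 *_) (countTop-reject ℓ v x≢top)) crowded

  -- Only t ≤ n can violate the bound defining ℬ, since countTop is at most n ≤ t - 1 otherwise.
  crowded-prefix : ∀ {n} {v : Vec ℕ n} → InBox q v → ¬ InB q v → Σ ℕ (λ ℓ → ℓ < 2 * countTop q ℓ v)
  crowded-prefix {n} {v} v∈box v∉B with FP.¬∀⟶∃¬ n (P ∘ toℕ) (P? ∘ toℕ) (λ ∀P → v∉B (v∈box , bounded ∀P))
    where
    P : ℕ → Set
    P t = countTop q (2 * suc t ∸ 1) v ≤ t
    P? : ∀ t → Dec (P t)
    P? t = countTop q (2 * suc t ∸ 1) v ≤? t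
    bounded : (∀ (t : Fin n) → P (toℕ t)) → ∀ t → 1 ≤ t → countTop q (2 * t ∸ 1) v ≤ t ∸ 1
    bounded ∀P (suc t) _ with t <? n
    ... | yes t<n = subst P (FP.toℕ-fromℕ< t<n) (∀P (F.fromℕ< t<n))
    ... | no  t≮n = ℕP.≤-trans (countTop-≤ (2 * suc t ∸ 1) v) (ℕP.≮⇒≥ t≮n)
  ... | t , ¬Pt = 2 * suc (toℕ t) ∸ 1 , ℕP.<-≤-trans (ℕP.n<1+n _) (ℕP.*-monoʳ-≤ 2 (ℕP.≰⇒> ¬Pt))

module Construction {n : ℕ} (O : MonomialOrder n) (varsDecreasing : VarsDecreasing O) (Q d : ℕ) where
  open TopTerms O
  open CappedExpansion {n} Q

  LeadingInIdeal : Mon n → Set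
  LeadingInIdeal v = Σ (Poly n) (λ f → VanishesOnU d (suc Q) f × IsLeadingMonomial O f v)

  leading-multiple : ∀ {p g κ} v → VanishesOnU d (suc Q) p → TopTerm p g κ → κ ≢ 0ℚ → g ∣ₘ v → LeadingInIdeal v
  leading-multiple {p} {g} {κ} v p∈I top κ≢0 g∣v = monomial (v ⊝ g) ⊗ p , f∈I ,
    subst (IsLeadingMonomial O (monomial (v ⊝ g) ⊗ p)) (v⊝g⊕g≡v g∣v)
      (TopTerm⇒IsLeadingMonomial (TopTerm-⊗ (TopTerm-single 1ℚ (v ⊝ g)) top) (κ≢0 ∘ trans (sym (ℚP.*-identityˡ κ))))
    where
    f∈I : VanishesOnU d (suc Q) (monomial (v ⊝ g) ⊗ p)
    f∈I u u∈U = trans (eval-⊗ (monomial (v ⊝ g)) p a) (trans (cong (eval (monomial (v ⊝ g)) a ·_) (p∈I u u∈U))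
                                                            (ℚP.*-zeroʳ (eval (monomial (v ⊝ g)) a)))
      where a = V.map fromℕℚ u

  leading-outside-box : ∀ v i → suc Q ≤ lookup v i → LeadingInIdeal v
  leading-outside-box v i q≤vᵢ = leading-multiple v vanish (TopTerm-fallingPoly i (suc Q)) ℚP.1≢0 divides
    where
    vanish : VanishesOnU d (suc Q) (fallingPoly i (suc Q))
    vanish u (u∈box , _) = trans (eval-fallingPoly i (suc Q) (V.map fromℕℚ u))
      (trans (cong (λ z → falling z (suc Q)) (VP.lookup-map i fromℕℚ u)) (falling-vanishes (u∈box i)))
    divides : varPow i (suc Q) ∣ₘ v
    divides j with i F.≟ j
    ... | yes refl = subst (_≤ lookup v i) (sym (lookup-varPow i (suc Q))) q≤vᵢ
    ... | no  i≢j  = subst (_≤ lookup v j) (sym (lookup-varPow-≢ (suc Q) i≢j)) z≤n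

  leading-from-split : 1 ≤ Q → ∀ v → TopSplit Q v 0 → LeadingInIdeal v
  leading-from-split 1≤Q v split = leading-multiple v vanish (TopTerm-expansion O varsDecreasing L c D sorted)
    (positive⇒≢0 (leadCoeff L c D) (leadCoeff-positive L c D D≤L)) (greedy-∣ₘ {v} T R D T-top D≤T sorted)
    where
    open TopSplit split
    k = length E
    D = suc (k * Q)
    c = fromℕℚ (k * Q) - fromℕℚ d
    L = T ++ R
    D≤T : D ≤ length T * Q
    D≤T = subst (λ t → D ≤ t * Q) (sym (trans length-T (ℕP.+-comm k 1))) (ℕP.+-monoˡ-≤ (k * Q) 1≤Q)
    D≤L : D ≤ length L * Q
    D≤L = ℕP.≤-trans D≤T (ℕP.*-monoˡ-≤ Q (subst (length T ≤_) (sym (LP.length-++ T)) (ℕP.m≤m+n _ _)))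
    vanish : VanishesOnU d (suc Q) (expansion L c D)
    vanish u (u∈box , Σu≡d) = begin
        eval (expansion L c D) (V.map fromℕℚ u)
      ≡⟨ eval-expansion L c D u (All.tabulate (λ {i} _ → u≤Q i)) ⟩
        falling (sumOverℚ L (V.map fromℕℚ u) + c) D
      ≡⟨ cong (λ z → falling (z + c) D) (sumOverℚ-fromℕℚ L u) ⟩
        falling (fromℕℚ sL + (fromℕℚ (k * Q) - fromℕℚ d)) D
      ≡⟨ cong₂ (λ x y → falling (fromℕℚ sL + (x - y)) D)
               (fromℕℚ-∸ sE≤kQ) (trans (cong fromℕℚ (sym sL+sE≡d)) (fromℕℚ-+ sL sE)) ⟩
        falling (fromℕℚ sL + ((fromℕℚ sE + fromℕℚ N) - (fromℕℚ sL + fromℕℚ sE))) D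
      ≡⟨ cong (λ z → falling z D) (cancel (fromℕℚ sL) (fromℕℚ sE) (fromℕℚ N)) ⟩
        falling (fromℕℚ N) D
      ≡⟨ falling-vanishes (s≤s (ℕP.m∸n≤m (k * Q) sE)) ⟩
        0ℚ ∎
      where
      open ≡-Reasoning
      u≤Q : ∀ i → lookup u i ≤ Q
      u≤Q i = ℕP.≤-pred (u∈box i)
      sL = sumOver L u
      sE = sumOver E u
      N = k * Q ∸ sE
      sE≤kQ : sE ≤ k * Q
      sE≤kQ = sumOver-≤ E u u≤Q
      sL+sE≡d : sL ℕ.+ sE ≡ d
      sL+sE≡d = trans (cong (ℕ._+ sE) (sumOver-++ T R u))
        (trans (swap (sumOver T u) (sumOver R u) sE) (trans (partition u) Σu≡d))
        where
        swap : ∀ x y z → x ℕ.+ y ℕ.+ z ≡ x ℕ.+ z ℕ.+ y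
        swap = ℕ-Solver.solve-∀
      cancel : ∀ x y z → x + ((y + z) - (x + y)) ≡ z
      cancel = solve-∀ ℚ-ring

proposition9 : (n q d : ℕ) → 2 ≤ q → 1 ≤ n → d ≤ (q ∸ 1) * n →
    (O : MonomialOrder n) → VarsDecreasing O →
    (v : Mon n) → ¬ InB q v →
    Σ (Poly n) (λ f → VanishesOnU d q f × IsLeadingMonomial O f v)
proposition9 n (suc (suc Q)) d (s≤s (s≤s z≤n)) _ _ O varsDecreasing v v∉B
  with FP.all? (λ i → lookup v i <? suc (suc Q))
... | no v∉box with FP.¬∀⟶∃¬ n _ (λ i → lookup v i <? suc (suc Q)) v∉box
...   | i , vᵢ≮q = leading-outside-box v i (ℕP.≮⇒≥ vᵢ≮q)
  where open Construction O varsDecreasing (suc Q) d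
proposition9 n (suc (suc Q)) d (s≤s (s≤s z≤n)) _ _ O varsDecreasing v v∉B | yes v∈box
  with crowded-prefix (suc (suc Q)) v∈box v∉B
... | ℓ , crowded = leading-from-split (s≤s z≤n) v (topSplit (suc (suc Q)) v 0 ℓ crowded)
  where open Construction O varsDecreasing (suc Q) d
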